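{- Let $\Gamma=\langle\rho_0,\rho_1,\rho_2\rangle$ be an sggi with $\sigma_1=\rho_0\rho_1$ and $\sigma_2=\rho_1\rho_2$. Then $\Gamma$ is tight if and only if for all integers $i,j$ there exist integers $f_1,f_2$ such that $\sigma_2^i\sigma_1^j=\sigma_1^{f_1}\sigma_2^{f_2}$ or $\sigma_2^i\sigma_1^j=\sigma_1^{f_1}\rho_1\sigma_2^{f_2}$.
   Context: An sggi (string group generated by involutions) of rank 3 is a group $\Gamma=\langle\rho_0,\rho_1,\rho_2\rangle$ with distinguished generators each of order 2 satisfying $(\rho_0\rho_2)^2=1$. With $\sigma_1=\rho_0\rho_1$ and $\sigma_2=\rho_1\rho_2$, the sggi is called tight if $\Gamma=\langle\sigma_1\rangle\langle\rho_1\rangle\langle\sigma_2\rangle$. -}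

module Defs where

open import Level using (Level; _⊔_)
open import Algebra.Bundles using (Group)
open import Data.Nat using (ℕ; zero; suc)
open import Data.Integer using (ℤ; +_; -[1+_])
open import Data.Product using (∃₂; _×_)
open import Data.Sum using (_⊎_)
open import Relation.Nullary using (¬_)

module GroupDefs {c ℓ : Level} (G : Group c ℓ) where
  open Group G

  _^ℕ_ : Carrier → ℕ → Carrier
  g ^ℕ zero  = ε
  g ^ℕ suc n = g ∙ (g ^ℕ n)

  _^ℤ_ : Carrier → ℤ → Carrier
  g ^ℤ (+ n)      = g ^ℕ n
  g ^ℤ -[1+ n ]   = (g ^ℕ suc n) ⁻¹

  data InGen (a b d : Carrier) : Carrier → Set (c ⊔ ℓ) where
    gen-a : InGen a b d a
    gen-b : InGen a b d b
    gen-d : InGen a b d d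
    gen-ε : InGen a b d ε
    gen-∙ : ∀ {x y} → InGen a b d x → InGen a b d y → InGen a b d (x ∙ y)
    gen-⁻¹ : ∀ {x} → InGen a b d x → InGen a b d (x ⁻¹)
    gen-≈ : ∀ {x y} → x ≈ y → InGen a b d x → InGen a b d y

  IsInvolution : Carrier → Set ℓ
  IsInvolution x = (¬ (x ≈ ε)) × ((x ∙ x) ≈ ε)

  record IsSggi (ρ₀ ρ₁ ρ₂ : Carrier) : Set (c ⊔ ℓ) where
    field
      inv₀ : IsInvolution ρ₀
      inv₁ : IsInvolution ρ₁
      inv₂ : IsInvolution ρ₂
      string : ((ρ₀ ∙ ρ₂) ∙ (ρ₀ ∙ ρ₂)) ≈ ε
      generates : ∀ g → InGen ρ₀ ρ₁ ρ₂ g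

  IsTight : (ρ₀ ρ₁ ρ₂ : Carrier) → Set (c ⊔ ℓ)
  IsTight ρ₀ ρ₁ ρ₂ =
    ∀ g → ∃₂ λ (a b : ℤ) →
      (g ≈ (((ρ₀ ∙ ρ₁) ^ℤ a) ∙ ((ρ₁ ∙ ρ₂) ^ℤ b)))
      ⊎ (g ≈ ((((ρ₀ ∙ ρ₁) ^ℤ a) ∙ ρ₁) ∙ ((ρ₁ ∙ ρ₂) ^ℤ b)))

-- Γ = ⟨ρ₀, ρ₁, ρ₂⟩ is generated by the involutions ρ₀ = σ₁ρ₁, ρ₁ and ρ₂ = ρ₁σ₂, so it equals
-- ⟨σ₁⟩⟨ρ₁⟩⟨σ₂⟩ as soon as this set is stable under left multiplication by σ₁, ρ₁ and σ₂. Since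
-- x · σ₁ᵃ ρ₁ᵉ σ₂ᵇ = (x σ₁ᵃ) ρ₁ᵉ σ₂ᵇ and the set is right-stable under ρ₁ (which inverts σ₂ by
-- conjugation) and under ⟨σ₂⟩, it suffices that x σ₁ᵃ lies in it: for σ₁ this is clear, for ρ₁
-- it holds because ρ₁ also inverts σ₁, and for σ₂ it is the hypothesis with i = 1.
module Submission where

open import Defs
open import Level using (Level)
open import Algebra.Bundles using (Group)
open import Data.Integer using (ℤ)
open import Data.Product using (∃₂)
open import Data.Sum using (_⊎_)
open import Function.Bundles using (_⇔_)

open import Data.Nat using (zero; suc)
open import Data.Integer using (+_; -[1+_]; _+_; -_; 1ℤ; -1ℤ) renaming (suc to sucℤ; pred to predℤ)
open import Data.Integer.Properties using (+-assoc; +-identityˡ; neg-involutive)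
open import Data.Product using (_,_; _×_; proj₁; proj₂)
open import Data.Sum using (inj₁; inj₂)
open import Function.Bundles using (mk⇔)
import Relation.Binary.PropositionalEquality as ≡
import Algebra.Properties.Group as GroupProperties
import Relation.Binary.Reasoning.Setoid as SetoidReasoning

module IntegerPowers {c ℓ : Level} (G : Group c ℓ) where
  open Group G
  open GroupDefs G
  open GroupProperties G
  open SetoidReasoning setoid

  ^ℤ-cong : ∀ g {a b} → a ≡.≡ b → g ^ℤ a ≈ g ^ℤ b
  ^ℤ-cong g a≡b = reflexive (≡.cong (g ^ℤ_) a≡b)

  ^ℕ-commute : ∀ g n → g ∙ g ^ℕ n ≈ g ^ℕ n ∙ g
  ^ℕ-commute g zero    = trans (identityʳ g) (sym (identityˡ g))
  ^ℕ-commute g (suc n) = trans (∙-congˡ (^ℕ-commute g n)) (sym (assoc g (g ^ℕ n) g))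

  ^ℕ-suc-⁻¹ : ∀ g n → (g ^ℕ suc n) ⁻¹ ≈ g ⁻¹ ∙ (g ^ℕ n) ⁻¹
  ^ℕ-suc-⁻¹ g n = trans (⁻¹-cong (^ℕ-commute g n)) (⁻¹-anti-homo-∙ (g ^ℕ n) g)

  ^ℤ-suc : ∀ g k → g ∙ g ^ℤ k ≈ g ^ℤ sucℤ k
  ^ℤ-suc g (+ n)          = refl
  ^ℤ-suc g -[1+ zero ]    = trans (∙-congˡ (⁻¹-cong (identityʳ g))) (inverseʳ g)
  ^ℤ-suc g -[1+ suc n ]   = begin
    g ∙ (g ^ℕ suc (suc n)) ⁻¹      ≈⟨ ∙-congˡ (^ℕ-suc-⁻¹ g (suc n)) ⟩
    g ∙ (g ⁻¹ ∙ (g ^ℕ suc n) ⁻¹)   ≈⟨ assoc _ _ _ ⟨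
    (g ∙ g ⁻¹) ∙ (g ^ℕ suc n) ⁻¹   ≈⟨ ∙-congʳ (inverseʳ g) ⟩
    ε ∙ (g ^ℕ suc n) ⁻¹            ≈⟨ identityˡ _ ⟩
    (g ^ℕ suc n) ⁻¹                ∎

  ^ℤ-pred : ∀ g k → g ⁻¹ ∙ g ^ℤ k ≈ g ^ℤ predℤ k
  ^ℤ-pred g (+ zero)    = trans (identityʳ _) (⁻¹-cong (sym (identityʳ g)))
  ^ℤ-pred g (+ suc n)   = begin
    g ⁻¹ ∙ (g ∙ g ^ℕ n)   ≈⟨ assoc _ _ _ ⟨
    (g ⁻¹ ∙ g) ∙ g ^ℕ n   ≈⟨ ∙-congʳ (inverseˡ g) ⟩
    ε ∙ g ^ℕ n            ≈⟨ identityˡ _ ⟩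
    g ^ℕ n                ∎
  ^ℤ-pred g -[1+ n ]    = sym (^ℕ-suc-⁻¹ g (suc n))

  ^ℤ-homo : ∀ g a b → g ^ℤ a ∙ g ^ℤ b ≈ g ^ℤ (a + b)
  ^ℤ-homo g (+ zero) b      = trans (identityˡ _) (^ℤ-cong g (≡.sym (+-identityˡ b)))
  ^ℤ-homo g (+ suc n) b     = begin
    (g ∙ g ^ℕ n) ∙ g ^ℤ b     ≈⟨ assoc _ _ _ ⟩
    g ∙ (g ^ℤ (+ n) ∙ g ^ℤ b) ≈⟨ ∙-congˡ (^ℤ-homo g (+ n) b) ⟩
    g ∙ g ^ℤ (+ n + b)        ≈⟨ ^ℤ-suc g (+ n + b) ⟩
    g ^ℤ sucℤ (+ n + b)       ≈⟨ ^ℤ-cong g (+-assoc 1ℤ (+ n) b) ⟨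
    g ^ℤ (+ suc n + b)        ∎
  ^ℤ-homo g -[1+ zero ] b   = trans (∙-congʳ (⁻¹-cong (identityʳ g))) (^ℤ-pred g b)
  ^ℤ-homo g -[1+ suc n ] b  = begin
    (g ^ℕ suc (suc n)) ⁻¹ ∙ g ^ℤ b         ≈⟨ ∙-congʳ (^ℕ-suc-⁻¹ g (suc n)) ⟩
    (g ⁻¹ ∙ (g ^ℕ suc n) ⁻¹) ∙ g ^ℤ b      ≈⟨ assoc _ _ _ ⟩
    g ⁻¹ ∙ (g ^ℤ -[1+ n ] ∙ g ^ℤ b)        ≈⟨ ∙-congˡ (^ℤ-homo g -[1+ n ] b) ⟩
    g ⁻¹ ∙ g ^ℤ (-[1+ n ] + b)             ≈⟨ ^ℤ-pred g (-[1+ n ] + b) ⟩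
    g ^ℤ predℤ (-[1+ n ] + b)              ≈⟨ ^ℤ-cong g (+-assoc -1ℤ -[1+ n ] b) ⟨
    g ^ℤ (-[1+ suc n ] + b)                ∎

module Involutions {c ℓ : Level} (G : Group c ℓ) where
  open Group G
  open GroupDefs G
  open GroupProperties G
  open SetoidReasoning setoid

  module _ {r : Carrier} (r²≈ε : r ∙ r ≈ ε) where

    involution-⁻¹ : r ⁻¹ ≈ r
    involution-⁻¹ = sym (inverseʳ-unique r r r²≈ε)

    involution-cancelˡ : ∀ y → r ∙ (r ∙ y) ≈ y
    involution-cancelˡ y = trans (sym (assoc _ _ _)) (trans (∙-congʳ r²≈ε) (identityˡ y))

    involution-cancelʳ : ∀ y → (y ∙ r) ∙ r ≈ y
    involution-cancelʳ y = trans (assoc _ _ _) (trans (∙-congˡ r²≈ε) (identityʳ y))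

    inverting-⁻¹ : ∀ {y} → r ∙ y ≈ y ⁻¹ ∙ r → r ∙ y ⁻¹ ≈ y ∙ r
    inverting-⁻¹ {y} ry≈y⁻¹r = begin
      r ∙ y ⁻¹               ≈⟨ ∙-congˡ (involution-cancelʳ (y ⁻¹)) ⟨
      r ∙ ((y ⁻¹ ∙ r) ∙ r)   ≈⟨ ∙-congˡ (∙-congʳ ry≈y⁻¹r) ⟨
      r ∙ ((r ∙ y) ∙ r)      ≈⟨ ∙-congˡ (assoc _ _ _) ⟩
      r ∙ (r ∙ (y ∙ r))      ≈⟨ involution-cancelˡ (y ∙ r) ⟩
      y ∙ r                  ∎

    module _ {x : Carrier} (rx≈x⁻¹r : r ∙ x ≈ x ⁻¹ ∙ r) where
      open IntegerPowers G using (^ℕ-suc-⁻¹)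

      inverting-^ℕ : ∀ n → r ∙ x ^ℕ n ≈ (x ^ℕ n) ⁻¹ ∙ r
      inverting-^ℕ zero    = trans (identityʳ r) (sym (trans (∙-congʳ ε⁻¹≈ε) (identityˡ r)))
      inverting-^ℕ (suc n) = begin
        r ∙ (x ∙ x ^ℕ n)               ≈⟨ assoc _ _ _ ⟨
        (r ∙ x) ∙ x ^ℕ n               ≈⟨ ∙-congʳ rx≈x⁻¹r ⟩
        (x ⁻¹ ∙ r) ∙ x ^ℕ n            ≈⟨ assoc _ _ _ ⟩
        x ⁻¹ ∙ (r ∙ x ^ℕ n)            ≈⟨ ∙-congˡ (inverting-^ℕ n) ⟩
        x ⁻¹ ∙ ((x ^ℕ n) ⁻¹ ∙ r)       ≈⟨ assoc _ _ _ ⟨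
        (x ⁻¹ ∙ (x ^ℕ n) ⁻¹) ∙ r       ≈⟨ ∙-congʳ (^ℕ-suc-⁻¹ x n) ⟨
        (x ^ℕ suc n) ⁻¹ ∙ r            ∎

      inverting-^ℤ : ∀ k → r ∙ x ^ℤ k ≈ x ^ℤ (- k) ∙ r
      inverting-^ℤ (+ zero)    = trans (identityʳ r) (sym (identityˡ r))
      inverting-^ℤ (+ suc n)   = inverting-^ℕ (suc n)
      inverting-^ℤ -[1+ n ]    = inverting-⁻¹ (inverting-^ℕ (suc n))

module LeftStability {c ℓ p : Level} (G : Group c ℓ) {P : Group.Carrier G → Set p}
  (P-resp : ∀ {x y} → Group._≈_ G x y → P x → P y) where
  open Group G
  open GroupDefs G
  open GroupProperties G

  LeftStable : Carrier → Set _
  LeftStable x = ∀ {s} → P s → P (x ∙ s)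

  leftStable-resp : ∀ {x y} → x ≈ y → LeftStable x → LeftStable y
  leftStable-resp x≈y stable Ps = P-resp (∙-congʳ x≈y) (stable Ps)

  leftStable-ε : LeftStable ε
  leftStable-ε Ps = P-resp (sym (identityˡ _)) Ps

  leftStable-∙ : ∀ {x y} → LeftStable x → LeftStable y → LeftStable (x ∙ y)
  leftStable-∙ stable-x stable-y Ps = P-resp (sym (assoc _ _ _)) (stable-x (stable-y Ps))

  leftStable-involution : ∀ {r} → r ∙ r ≈ ε → LeftStable r → LeftStable r × LeftStable (r ⁻¹)
  leftStable-involution r²≈ε stable =
    stable , leftStable-resp (sym (Involutions.involution-⁻¹ G r²≈ε)) stable

  leftStable-InGen : ∀ {a b d} →
    LeftStable a × LeftStable (a ⁻¹) → LeftStable b × LeftStable (b ⁻¹) →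
    LeftStable d × LeftStable (d ⁻¹) →
    ∀ {x} → InGen a b d x → LeftStable x × LeftStable (x ⁻¹)
  leftStable-InGen stable-a stable-b stable-d = go
    where
    go : ∀ {x} → InGen _ _ _ x → LeftStable x × LeftStable (x ⁻¹)
    go gen-a = stable-a
    go gen-b = stable-b
    go gen-d = stable-d
    go gen-ε = leftStable-ε , leftStable-resp (sym ε⁻¹≈ε) leftStable-ε
    go (gen-∙ {x} {y} x∈ y∈) =
      leftStable-∙ (proj₁ (go x∈)) (proj₁ (go y∈)) ,
      leftStable-resp (sym (⁻¹-anti-homo-∙ x y)) (leftStable-∙ (proj₂ (go y∈)) (proj₂ (go x∈)))
    go (gen-⁻¹ {x} x∈) = proj₂ (go x∈) , leftStable-resp (sym (⁻¹-involutive x)) (proj₁ (go x∈))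
    go (gen-≈ x≈y x∈) = leftStable-resp x≈y (proj₁ (go x∈)) , leftStable-resp (⁻¹-cong x≈y) (proj₂ (go x∈))

module TightProduct {c ℓ : Level} (G : Group c ℓ) (ρ₀ ρ₁ ρ₂ : Group.Carrier G)
  (ρ₀²≈ε : Group._≈_ G (Group._∙_ G ρ₀ ρ₀) (Group.ε G))
  (ρ₁²≈ε : Group._≈_ G (Group._∙_ G ρ₁ ρ₁) (Group.ε G))
  (ρ₂²≈ε : Group._≈_ G (Group._∙_ G ρ₂ ρ₂) (Group.ε G)) where
  open Group G
  open GroupDefs G
  open GroupProperties G
  open SetoidReasoning setoid
  open IntegerPowers G
  open Involutions G

  σ₁ σ₂ : Carrier
  σ₁ = ρ₀ ∙ ρ₁
  σ₂ = ρ₁ ∙ ρ₂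

  In⟨σ₁⟩⟨ρ₁⟩⟨σ₂⟩ : Carrier → Set _
  In⟨σ₁⟩⟨ρ₁⟩⟨σ₂⟩ g = ∃₂ λ (a b : ℤ) →
    (g ≈ σ₁ ^ℤ a ∙ σ₂ ^ℤ b) ⊎ (g ≈ (σ₁ ^ℤ a ∙ ρ₁) ∙ σ₂ ^ℤ b)

  in-product-resp : ∀ {x y} → x ≈ y → In⟨σ₁⟩⟨ρ₁⟩⟨σ₂⟩ x → In⟨σ₁⟩⟨ρ₁⟩⟨σ₂⟩ y
  in-product-resp x≈y (a , b , inj₁ p) = a , b , inj₁ (trans (sym x≈y) p)
  in-product-resp x≈y (a , b , inj₂ p) = a , b , inj₂ (trans (sym x≈y) p)

  open LeftStability G in-product-resp

  ρ₁σ₁≈σ₁⁻¹ρ₁ : ρ₁ ∙ σ₁ ≈ σ₁ ⁻¹ ∙ ρ₁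
  ρ₁σ₁≈σ₁⁻¹ρ₁ = begin
    ρ₁ ∙ (ρ₀ ∙ ρ₁)          ≈⟨ assoc _ _ _ ⟨
    (ρ₁ ∙ ρ₀) ∙ ρ₁          ≈⟨ ∙-congʳ (∙-cong (involution-⁻¹ ρ₁²≈ε) (involution-⁻¹ ρ₀²≈ε)) ⟨
    (ρ₁ ⁻¹ ∙ ρ₀ ⁻¹) ∙ ρ₁    ≈⟨ ∙-congʳ (⁻¹-anti-homo-∙ ρ₀ ρ₁) ⟨
    (ρ₀ ∙ ρ₁) ⁻¹ ∙ ρ₁       ∎

  ρ₁σ₂≈σ₂⁻¹ρ₁ : ρ₁ ∙ σ₂ ≈ σ₂ ⁻¹ ∙ ρ₁
  ρ₁σ₂≈σ₂⁻¹ρ₁ = begin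
    ρ₁ ∙ (ρ₁ ∙ ρ₂)          ≈⟨ involution-cancelˡ ρ₁²≈ε ρ₂ ⟩
    ρ₂                      ≈⟨ involution-cancelʳ ρ₁²≈ε ρ₂ ⟨
    (ρ₂ ∙ ρ₁) ∙ ρ₁          ≈⟨ ∙-congʳ (∙-cong (involution-⁻¹ ρ₂²≈ε) (involution-⁻¹ ρ₁²≈ε)) ⟨
    (ρ₂ ⁻¹ ∙ ρ₁ ⁻¹) ∙ ρ₁    ≈⟨ ∙-congʳ (⁻¹-anti-homo-∙ ρ₁ ρ₂) ⟨
    (ρ₁ ∙ ρ₂) ⁻¹ ∙ ρ₁       ∎

  σ₂^∙ρ₁ : ∀ k → σ₂ ^ℤ k ∙ ρ₁ ≈ ρ₁ ∙ σ₂ ^ℤ (- k)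
  σ₂^∙ρ₁ k = sym (begin
    ρ₁ ∙ σ₂ ^ℤ (- k)        ≈⟨ inverting-^ℤ ρ₁²≈ε ρ₁σ₂≈σ₂⁻¹ρ₁ (- k) ⟩
    σ₂ ^ℤ (- (- k)) ∙ ρ₁    ≈⟨ ∙-congʳ (^ℤ-cong σ₂ (neg-involutive k)) ⟩
    σ₂ ^ℤ k ∙ ρ₁            ∎)

  in-product-∙σ₂^ : ∀ {s} k → In⟨σ₁⟩⟨ρ₁⟩⟨σ₂⟩ s → In⟨σ₁⟩⟨ρ₁⟩⟨σ₂⟩ (s ∙ σ₂ ^ℤ k)
  in-product-∙σ₂^ k (a , b , inj₁ p) = a , b + k , inj₁ (begin
    _ ∙ σ₂ ^ℤ k                     ≈⟨ ∙-congʳ p ⟩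
    (σ₁ ^ℤ a ∙ σ₂ ^ℤ b) ∙ σ₂ ^ℤ k   ≈⟨ assoc _ _ _ ⟩
    σ₁ ^ℤ a ∙ (σ₂ ^ℤ b ∙ σ₂ ^ℤ k)   ≈⟨ ∙-congˡ (^ℤ-homo σ₂ b k) ⟩
    σ₁ ^ℤ a ∙ σ₂ ^ℤ (b + k)         ∎)
  in-product-∙σ₂^ k (a , b , inj₂ p) = a , b + k , inj₂ (begin
    _ ∙ σ₂ ^ℤ k                            ≈⟨ ∙-congʳ p ⟩
    ((σ₁ ^ℤ a ∙ ρ₁) ∙ σ₂ ^ℤ b) ∙ σ₂ ^ℤ k   ≈⟨ assoc _ _ _ ⟩
    (σ₁ ^ℤ a ∙ ρ₁) ∙ (σ₂ ^ℤ b ∙ σ₂ ^ℤ k)   ≈⟨ ∙-congˡ (^ℤ-homo σ₂ b k) ⟩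
    (σ₁ ^ℤ a ∙ ρ₁) ∙ σ₂ ^ℤ (b + k)         ∎)

  in-product-∙ρ₁ : ∀ {s} → In⟨σ₁⟩⟨ρ₁⟩⟨σ₂⟩ s → In⟨σ₁⟩⟨ρ₁⟩⟨σ₂⟩ (s ∙ ρ₁)
  in-product-∙ρ₁ (a , b , inj₁ p) = a , - b , inj₂ (begin
    _ ∙ ρ₁                            ≈⟨ ∙-congʳ p ⟩
    (σ₁ ^ℤ a ∙ σ₂ ^ℤ b) ∙ ρ₁          ≈⟨ assoc _ _ _ ⟩
    σ₁ ^ℤ a ∙ (σ₂ ^ℤ b ∙ ρ₁)          ≈⟨ ∙-congˡ (σ₂^∙ρ₁ b) ⟩
    σ₁ ^ℤ a ∙ (ρ₁ ∙ σ₂ ^ℤ (- b))      ≈⟨ assoc _ _ _ ⟨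
    (σ₁ ^ℤ a ∙ ρ₁) ∙ σ₂ ^ℤ (- b)      ∎)
  in-product-∙ρ₁ (a , b , inj₂ p) = a , - b , inj₁ (begin
    _ ∙ ρ₁                                ≈⟨ ∙-congʳ p ⟩
    ((σ₁ ^ℤ a ∙ ρ₁) ∙ σ₂ ^ℤ b) ∙ ρ₁       ≈⟨ assoc _ _ _ ⟩
    (σ₁ ^ℤ a ∙ ρ₁) ∙ (σ₂ ^ℤ b ∙ ρ₁)       ≈⟨ ∙-congˡ (σ₂^∙ρ₁ b) ⟩
    (σ₁ ^ℤ a ∙ ρ₁) ∙ (ρ₁ ∙ σ₂ ^ℤ (- b))   ≈⟨ assoc _ _ _ ⟩
    σ₁ ^ℤ a ∙ (ρ₁ ∙ (ρ₁ ∙ σ₂ ^ℤ (- b)))   ≈⟨ ∙-congˡ (involution-cancelˡ ρ₁²≈ε _) ⟩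
    σ₁ ^ℤ a ∙ σ₂ ^ℤ (- b)                 ∎)

  in-product-σ₁^ : ∀ a → In⟨σ₁⟩⟨ρ₁⟩⟨σ₂⟩ (σ₁ ^ℤ a)
  in-product-σ₁^ a = a , + 0 , inj₁ (sym (identityʳ _))

  in-product-σ₁^ρ₁ : ∀ a → In⟨σ₁⟩⟨ρ₁⟩⟨σ₂⟩ (σ₁ ^ℤ a ∙ ρ₁)
  in-product-σ₁^ρ₁ a = a , + 0 , inj₂ (sym (identityʳ _))

  leftStable-if-∙σ₁^ : ∀ {x} → (∀ a → In⟨σ₁⟩⟨ρ₁⟩⟨σ₂⟩ (x ∙ σ₁ ^ℤ a)) → LeftStable x
  leftStable-if-∙σ₁^ {x} xσ₁^∈ (a , b , inj₁ p) =
    in-product-resp (sym (trans (∙-congˡ p) (sym (assoc _ _ _))))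
      (in-product-∙σ₂^ b (xσ₁^∈ a))
  leftStable-if-∙σ₁^ {x} xσ₁^∈ (a , b , inj₂ p) =
    in-product-resp (sym (trans (∙-congˡ p) (trans (sym (assoc _ _ _)) (∙-congʳ (sym (assoc _ _ _))))))
      (in-product-∙σ₂^ b (in-product-∙ρ₁ (xσ₁^∈ a)))

  leftStable-σ₁ : LeftStable σ₁
  leftStable-σ₁ = leftStable-if-∙σ₁^ λ a →
    in-product-resp (sym (^ℤ-suc σ₁ a)) (in-product-σ₁^ (sucℤ a))

  leftStable-ρ₁ : LeftStable ρ₁
  leftStable-ρ₁ = leftStable-if-∙σ₁^ λ a →
    in-product-resp (sym (inverting-^ℤ ρ₁²≈ε ρ₁σ₁≈σ₁⁻¹ρ₁ a)) (in-product-σ₁^ρ₁ (- a))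

  leftStable-ρ₀ : LeftStable ρ₀
  leftStable-ρ₀ = leftStable-resp (involution-cancelʳ ρ₁²≈ε ρ₀) (leftStable-∙ leftStable-σ₁ leftStable-ρ₁)

  module _ (σ₂σ₁^∈ : ∀ a → In⟨σ₁⟩⟨ρ₁⟩⟨σ₂⟩ (σ₂ ∙ σ₁ ^ℤ a)) where

    leftStable-ρ₂ : LeftStable ρ₂
    leftStable-ρ₂ = leftStable-resp (involution-cancelˡ ρ₁²≈ε ρ₂)
      (leftStable-∙ leftStable-ρ₁ (leftStable-if-∙σ₁^ σ₂σ₁^∈))

    in-product-InGen : ∀ {g} → InGen ρ₀ ρ₁ ρ₂ g → In⟨σ₁⟩⟨ρ₁⟩⟨σ₂⟩ g
    in-product-InGen g∈ = in-product-resp (identityʳ _)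
      (proj₁ (leftStable-InGen (leftStable-involution ρ₀²≈ε leftStable-ρ₀)
                               (leftStable-involution ρ₁²≈ε leftStable-ρ₁)
                               (leftStable-involution ρ₂²≈ε leftStable-ρ₂) g∈)
        (in-product-σ₁^ (+ 0)))

proposition2p6 : {c ℓ : Level} (G : Group c ℓ) (ρ₀ ρ₁ ρ₂ : Group.Carrier G) →
    GroupDefs.IsSggi G ρ₀ ρ₁ ρ₂ →
    let open Group G
        open GroupDefs G
        σ₁ = ρ₀ ∙ ρ₁
        σ₂ = ρ₁ ∙ ρ₂
    in IsTight ρ₀ ρ₁ ρ₂ ⇔
       (∀ (i j : ℤ) → ∃₂ λ (f₁ f₂ : ℤ) →
          ((σ₂ ^ℤ i) ∙ (σ₁ ^ℤ j)) ≈ ((σ₁ ^ℤ f₁) ∙ (σ₂ ^ℤ f₂))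
          ⊎ ((σ₂ ^ℤ i) ∙ (σ₁ ^ℤ j)) ≈ (((σ₁ ^ℤ f₁) ∙ ρ₁) ∙ (σ₂ ^ℤ f₂)))
proposition2p6 G ρ₀ ρ₁ ρ₂ sggi = mk⇔ (λ tight i j → tight _) (λ swap g →
  in-product-InGen (λ a → in-product-resp (∙-congʳ (identityʳ σ₂)) (swap (+ 1) a)) (generates g))
  where
  open Group G
  open GroupDefs.IsSggi sggi
  open TightProduct G ρ₀ ρ₁ ρ₂ (proj₂ inv₀) (proj₂ inv₁) (proj₂ inv₂)
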